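{- Let $n$ be a positive integer, $T\subset\mathbb{Q}\cup\{\infty\}$ finite, and $\mathscr{M}$ an $n\times n$ RK puzzle with slope set $T$. Let $\omega=(w_1,\dots,w_m)$ be a sequence of non-negative integers with $\omega(1,m)\le n$ such that (1) there is a positive integer $m_0\le m$ with $(w_1,\dots,w_{m_0})$ non-increasing and $\{w_{m_0+1},\dots,w_m\}\subset\{0,1\}$; and (2) every entry of $\mathscr{M}$ at a point of $J_\omega=\bigcup_{i=1}^m I_{\omega(i,m),i}$ is uniquely solvable. Let $1\le j\le m_0+1$ and suppose there is $q$ with $-1/q\in T$ and $w_j+1\le q\le w_{j-1}-1$ (where for $j=1$ the upper bound is vacuous, and for $j=m+1$ one sets $w_{m+1}=0$). Then the entry at the point $(\omega(j,m)+1,\,j)$ (whenever this point lies in $I_{n,n}$) is uniquely solvable.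
   Context: For a positive integer $n$ let $I_n=\{1,\dots,n\}$, $I_0=\emptyset$, and $I_{a,b}=I_a\times I_b\subset\mathbb{R}^2$ (first coordinate horizontal). For $\omega=(w_1,\dots,w_m)$ and $1\le i\le j\le m$, $\omega(i,j)=\sum_{k=i}^j w_k$; an empty sum is $0$. For a slope $s\in\mathbb{Q}\cup\{\infty\}$ let $\mathscr{L}_s$ be the set of lines of slope $s$ meeting $I_{n,n}$, and $P_{\ell,s}(X)=\sum_{(x,y)\in\ell\cap I_{n,n}}X_{x,y}$. An $n\times n$ RK puzzle with finite slope set $T$ is a system of one equation $P_{\ell,t}(X)=c_{\ell,t}$ (arbitrary $c_{\ell,t}\in\mathbb{R}$) for each $t\in T$, $\ell\in\mathscr{L}_t$; solutions are real solutions. The entry at $(x,y)\in I_{n,n}$ is the variable $X_{x,y}$; it is uniquely solvable if all solutions of the puzzle have the same value of $X_{x,y}$.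
   Formalization: The constants $c_{\ell,t}$ and the solutions of the puzzle are rational rather than real. -}

module Defs where

open import Data.Nat using (ℕ; zero; suc; _+_; _∸_; _≤_; _<_)
open import Data.Integer using (ℤ; +_; -[1+_])
open import Data.Rational as ℚ using (ℚ; _/_; _≟_)
open import Data.List using (List; []; _∷_; map; upTo; foldr)
open import Data.Nat.ListAction using (sum)
open import Data.List.Membership.Propositional using (_∈_)
open import Data.Product using (_×_)
open import Relation.Nullary using (yes; no)
open import Relation.Binary.PropositionalEquality using (_≡_)

data Slope : Set where
  fin : ℚ → Slope
  inf : Slope

ℕtoℚ : ℕ → ℚ
ℕtoℚ k = (+ k) / 1

-- A line of slope s is identified by a key:
--   finite slope t : the intercept y - t·x  (line y = t·x + key)
--   slope ∞        : the x–coordinate       (line x = key)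
-- Two points lie on the same line of slope s iff their keys agree.
key : Slope → ℕ → ℕ → ℚ
key (fin t) x y = ℚ._-_ (ℕtoℚ y) (ℚ._*_ t (ℕtoℚ x))
key inf     x y = ℕtoℚ x

range1 : ℕ → List ℕ
range1 n = map suc (upTo n)

rangeIJ : ℕ → ℕ → List ℕ
rangeIJ i j = map (λ k → i + k) (upTo (suc j ∸ i))

sumℚ : List ℚ → ℚ
sumℚ = foldr ℚ._+_ (ℚ.0ℚ)

InGrid : ℕ → ℕ → ℕ → Set
InGrid n x y = (1 ≤ x × x ≤ n) × (1 ≤ y × y ≤ n)

-- An assignment of real (here: rational) values to the variables X_{x,y};
-- only values at grid points matter.
Assignment : Set
Assignment = ℕ → ℕ → ℚ

lineSum : ℕ → Slope → ℚ → Assignment → ℚ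
lineSum n s k X =
  sumℚ (map (λ x → sumℚ (map (λ y → sel x y (key s x y ≟ k)) (range1 n))) (range1 n))
  where
  sel : (x y : ℕ) → _ → ℚ
  sel x y (yes _) = X x y
  sel x y (no _)  = ℚ.0ℚ

-- Constants of an RK puzzle: c s k is the right-hand side c_{ℓ,s} for the line ℓ
-- of slope s with key k (values for lines missing the grid are irrelevant).
Constants : Set
Constants = Slope → ℚ → ℚ

-- X solves the n×n RK puzzle with slope set T and constants c:
-- for every t ∈ T and every line ℓ of slope t meeting I_{n,n}
-- (i.e. every line through some grid point), P_{ℓ,t}(X) = c_{ℓ,t}.
Solves : ℕ → List Slope → Constants → Assignment → Set
Solves n T c X =
  ∀ t → t ∈ T → ∀ x y → InGrid n x y → lineSum n t (key t x y) X ≡ c t (key t x y)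

UniquelySolvable : ℕ → List Slope → Constants → ℕ → ℕ → Set
UniquelySolvable n T c x y =
  ∀ X Y → Solves n T c X → Solves n T c Y → X x y ≡ Y x y

-- w_i (1-indexed) of ω = (w_1,…,w_m); 0 outside 1..m (so w_{m+1} = 0).
wAt : List ℕ → ℕ → ℕ
wAt []       _             = 0
wAt (w ∷ ws) zero          = 0
wAt (w ∷ ws) (suc zero)    = w
wAt (w ∷ ws) (suc (suc i)) = wAt ws (suc i)

ωsum : List ℕ → ℕ → ℕ → ℕ
ωsum ws i j = sum (map (wAt ws) (rangeIJ i j))

-- -1/q as a rational (q ≥ 1; value at q = 0 is an irrelevant dummy)
negRecip : ℕ → ℚ
negRecip zero    = ℚ.0ℚ
negRecip (suc k) = -[1+ 0 ] / suc k

{-# OPTIONS --safe #-}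
-- Let p = (ω(j,m) + 1, j) and consider the line of slope −1/q through p; along it q·y + x is
-- constant. Put level(y) = q·y + ω(y,m), the value of q·y + x at the last point of row y of J_ω.
-- Since level(y) − level(y+1) = w_y − q, level strictly decreases before j (there w_y ≥ w_{j−1} > q),
-- strictly increases at j (w_j < q) and never decreases after j (w_y ≤ q), so j is its strict
-- minimum. Every other grid point (x, y) on the line has q·y + x = level(j) + 1 ≤ level(y), hence
-- lies in J_ω, where entries are uniquely solvable; the equation of the line then fixes the entry at p.
module Submission where

open import Defs
open import Data.Nat
open import Data.Nat.Properties
open import Data.Nat.ListAction using (sum)
import Data.Nat.Solver as ℕ
open import Data.Integer as ℤ using (-[1+_]; +[1+_])
import Data.Integer.Properties as ℤ
import Data.Integer.Solver as ℤ
open import Data.Rational as ℚ using (ℚ; toℚᵘ)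
import Data.Rational.Properties as ℚ
open import Data.Rational.Unnormalised as ℚᵘ using (mkℚᵘ; *≡*)
import Data.Rational.Unnormalised.Properties as ℚᵘ
open import Algebra.Properties.Group ℚ.+-0-group using (∙-cancelˡ; ∙-cancelʳ)
open import Data.List using (List; []; _∷_; map; upTo; applyUpTo; length)
open import Data.List.Properties using (map-upTo; map-∘; map-cong)
open import Data.List.Membership.Propositional using (_∈_)
open import Data.List.Membership.Propositional.Properties using (∈-map⁺; ∈-map⁻; ∈-upTo⁺; ∈-upTo⁻)
open import Data.List.Relation.Unary.Any using (here; there)
import Data.List.Relation.Unary.All as All
open import Data.List.Relation.Unary.AllPairs using (_∷_)
open import Data.List.Relation.Unary.Unique.Propositional using (Unique)
import Data.List.Relation.Unary.Unique.Propositional.Properties as Unique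
open import Data.Product using (Σ; _×_; _,_; proj₁; proj₂)
open import Data.Sum using (_⊎_; inj₁; inj₂)
open import Function using (_∘_; flip)
open import Relation.Binary using (Rel; Reflexive; Transitive; tri<; tri≈; tri>)
open import Relation.Nullary using (yes; no; contradiction)
open import Relation.Binary.PropositionalEquality

sumℚ-cong : ∀ {f g : ℕ → ℚ} {l} → (∀ a → a ∈ l → f a ≡ g a) → sumℚ (map f l) ≡ sumℚ (map g l)
sumℚ-cong {l = []}    _     = refl
sumℚ-cong {l = a ∷ l} f≗g = cong₂ ℚ._+_ (f≗g a (here refl)) (sumℚ-cong (λ b → f≗g b ∘ there))

sumℚ-cancel : ∀ {f g : ℕ → ℚ} {a l} → Unique l → a ∈ l →
  (∀ b → b ∈ l → b ≢ a → f b ≡ g b) → sumℚ (map f l) ≡ sumℚ (map g l) → f a ≡ g a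
sumℚ-cancel {f} {g} {a} {_ ∷ l} (a∉l ∷ _) (here refl) agree eq =
  ∙-cancelʳ _ (f a) (g a) (trans (cong (f a ℚ.+_) (sym rest≡)) eq)
  where
  rest≡ : sumℚ (map f l) ≡ sumℚ (map g l)
  rest≡ = sumℚ-cong (λ b b∈l → agree b (there b∈l) (≢-sym (All.lookup a∉l b∈l)))
sumℚ-cancel {f} {g} {l = h ∷ _} (h∉l ∷ l-unique) (there a∈l) agree eq =
  sumℚ-cancel l-unique a∈l (λ b → agree b ∘ there)
    (∙-cancelˡ (f h) _ _ (trans eq (cong (ℚ._+ _) (sym head≡))))
  where
  head≡ : f h ≡ g h
  head≡ = agree _ (here refl) (All.lookup h∉l a∈l)

range1-unique : ∀ n → Unique (range1 n)
range1-unique n = Unique.map⁺ suc-injective (Unique.upTo⁺ n)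

∈-range1⁺ : ∀ {n a} → 1 ≤ a → a ≤ n → a ∈ range1 n
∈-range1⁺ {a = suc a} (s≤s z≤n) a≤n = ∈-map⁺ suc (∈-upTo⁺ a≤n)

∈-range1⁻ : ∀ {n a} → a ∈ range1 n → 1 ≤ a × a ≤ n
∈-range1⁻ a∈ with ∈-map⁻ suc a∈
... | _ , b∈ , refl = s≤s z≤n , ∈-upTo⁻ b∈

gridSum : ℕ → (ℕ → ℕ → ℚ) → ℚ
gridSum n F = sumℚ (map (λ x → sumℚ (map (F x) (range1 n))) (range1 n))

gridSum-cancel : ∀ {n} {F G : ℕ → ℕ → ℚ} {px py} → InGrid n px py →
  (∀ x y → InGrid n x y → (x , y) ≢ (px , py) → F x y ≡ G x y) →
  gridSum n F ≡ gridSum n G → F px py ≡ G px py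
gridSum-cancel {n} {F} {G} {px} ((1≤px , px≤n) , (1≤py , py≤n)) agree eq =
  sumℚ-cancel (range1-unique n) (∈-range1⁺ 1≤py py≤n)
    (λ y y∈ y≢py → agree px y ((1≤px , px≤n) , ∈-range1⁻ y∈) (y≢py ∘ cong proj₂))
    (sumℚ-cancel (range1-unique n) (∈-range1⁺ 1≤px px≤n) rows-agree eq)
  where
  rows-agree : ∀ x → x ∈ range1 n → x ≢ px → sumℚ (map (F x) (range1 n)) ≡ sumℚ (map (G x) (range1 n))
  rows-agree x x∈ x≢px =
    sumℚ-cong (λ y y∈ → agree x y (∈-range1⁻ x∈ , ∈-range1⁻ y∈) (x≢px ∘ cong proj₁))

-- The summand of lineSum is local to its where-block in Defs; unification recovers it.
private
  lineSum-as-gridSum : ∀ n s k X → Σ (ℕ → ℕ → ℚ) λ F → lineSum n s k X ≡ gridSum n F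
  lineSum-as-gridSum n s k X = _ , refl

lineTerm : ℕ → Slope → ℚ → Assignment → ℕ → ℕ → ℚ
lineTerm n s k X = proj₁ (lineSum-as-gridSum n s k X)

lineTerm-on : ∀ n s X {k x y} → key s x y ≡ k → lineTerm n s k X x y ≡ X x y
lineTerm-on n s X {k} {x} {y} on with key s x y ℚ.≟ k
... | yes _  = refl
... | no off = contradiction on off

lineSum-cancel : ∀ {n s} {X Y : Assignment} {px py} → InGrid n px py →
  (∀ x y → InGrid n x y → key s x y ≡ key s px py → (x , y) ≢ (px , py) → X x y ≡ Y x y) →
  lineSum n s (key s px py) X ≡ lineSum n s (key s px py) Y → X px py ≡ Y px py
lineSum-cancel {n} {s} {X} {Y} {px} {py} p∈grid agree eq = begin
  X px py            ≡⟨ lineTerm-on n s X refl ⟨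
  lineTerm′ X px py  ≡⟨ gridSum-cancel p∈grid terms-agree eq ⟩
  lineTerm′ Y px py  ≡⟨ lineTerm-on n s Y refl ⟩
  Y px py            ∎
  where
  open ≡-Reasoning
  lineTerm′ : Assignment → ℕ → ℕ → ℚ
  lineTerm′ = lineTerm n s (key s px py)
  terms-agree : ∀ x y → InGrid n x y → (x , y) ≢ (px , py) → lineTerm′ X x y ≡ lineTerm′ Y x y
  terms-agree x y xy∈grid xy≢p with key s x y ℚ.≟ key s px py
  ... | yes on = agree x y xy∈grid on xy≢p
  ... | no _   = refl

toℚᵘ-key-negRecip : ∀ r x y →
  toℚᵘ (key (fin (negRecip (suc r))) x y) ℚᵘ.≃ mkℚᵘ (ℤ.+ (suc r * y + x)) r
toℚᵘ-key-negRecip r x y = begin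
  toℚᵘ (ℕtoℚ y ℚ.- negRecip (suc r) ℚ.* ℕtoℚ x)
    ≈⟨ ℚ.toℚᵘ-homo-+ (ℕtoℚ y) _ ⟩
  toℚᵘ (ℕtoℚ y) ℚᵘ.+ toℚᵘ (ℚ.- (negRecip (suc r) ℚ.* ℕtoℚ x))
    ≈⟨ ℚᵘ.+-congʳ (toℚᵘ (ℕtoℚ y)) (ℚ.toℚᵘ-homo‿- (negRecip (suc r) ℚ.* ℕtoℚ x)) ⟩
  toℚᵘ (ℕtoℚ y) ℚᵘ.- toℚᵘ (negRecip (suc r) ℚ.* ℕtoℚ x)
    ≈⟨ ℚᵘ.+-congʳ (toℚᵘ (ℕtoℚ y)) (ℚᵘ.-‿cong (ℚ.toℚᵘ-homo-* (negRecip (suc r)) (ℕtoℚ x))) ⟩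
  toℚᵘ (ℕtoℚ y) ℚᵘ.- toℚᵘ (negRecip (suc r)) ℚᵘ.* toℚᵘ (ℕtoℚ x)
    -- ℕtoℚ k and negRecip (suc r) are fromℚᵘ of the evident mkℚᵘ terms by definition.
    ≈⟨ ℚᵘ.+-cong (ℚ.toℚᵘ-fromℚᵘ (mkℚᵘ (ℤ.+ y) 0))
                 (ℚᵘ.-‿cong (ℚᵘ.*-cong (ℚ.toℚᵘ-fromℚᵘ (mkℚᵘ -[1+ 0 ] r))
                                       (ℚ.toℚᵘ-fromℚᵘ (mkℚᵘ (ℤ.+ x) 0)))) ⟩
  mkℚᵘ (ℤ.+ y) 0 ℚᵘ.- mkℚᵘ -[1+ 0 ] r ℚᵘ.* mkℚᵘ (ℤ.+ x) 0
    ≈⟨ *≡* (cross-multiplied (ℤ.+ y) (ℤ.+ x)) ⟩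
  mkℚᵘ (+[1+ r ] ℤ.* ℤ.+ y ℤ.+ ℤ.+ x) r
    ≡⟨ cong (λ n → mkℚᵘ n r) (trans (ℤ.pos-+ (suc r * y) x) (cong (ℤ._+ ℤ.+ x) (ℤ.pos-* (suc r) y))) ⟨
  mkℚᵘ (ℤ.+ (suc r * y + x)) r ∎
  where
  open ℚᵘ.≃-Reasoning
  cross-multiplied : ∀ a b → (a ℤ.* +[1+ r * 1 ] ℤ.+ ℤ.- (-[1+ 0 ] ℤ.* b) ℤ.* ℤ.+ 1) ℤ.* +[1+ r ]
                             ≡ (+[1+ r ] ℤ.* a ℤ.+ b) ℤ.* +[1+ r * 1 + 0 ]
  cross-multiplied a b rewrite *-identityʳ r | +-identityʳ r =
    solve 3 (λ a b q → (a :* q :+ :- (:- con (ℤ.+ 1) :* b) :* con (ℤ.+ 1)) :* q := (q :* a :+ b) :* q)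
      refl a b +[1+ r ]
    where open ℤ.+-*-Solver

mkℚᵘ-injectiveˡ : ∀ {a b r} → mkℚᵘ a r ℚᵘ.≃ mkℚᵘ b r → a ≡ b
mkℚᵘ-injectiveˡ {r = r} (*≡* cross) = ℤ.*-cancelʳ-≡ _ _ +[1+ r ] cross

key-negRecip-injective : ∀ r {x y x′ y′} →
  key (fin (negRecip (suc r))) x y ≡ key (fin (negRecip (suc r))) x′ y′ → suc r * y + x ≡ suc r * y′ + x′
key-negRecip-injective r {x} {y} {x′} {y′} same-key = ℤ.+-injective (mkℚᵘ-injectiveˡ (begin
  mkℚᵘ (ℤ.+ (suc r * y + x)) r                 ≈⟨ toℚᵘ-key-negRecip r x y ⟨
  toℚᵘ (key (fin (negRecip (suc r))) x y)      ≡⟨ cong toℚᵘ same-key ⟩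
  toℚᵘ (key (fin (negRecip (suc r))) x′ y′)    ≈⟨ toℚᵘ-key-negRecip r x′ y′ ⟩
  mkℚᵘ (ℤ.+ (suc r * y′ + x′)) r               ∎))
  where open ℚᵘ.≃-Reasoning

adjacent⇒endpoints : ∀ {ℓ} {A : Set} {R : Rel A ℓ} {f : ℕ → A} → Reflexive R → Transitive R →
  ∀ {a b} → a ≤ b → (∀ i → a ≤ i → i < b → R (f i) (f (suc i))) → R (f a) (f b)
adjacent⇒endpoints {R = R} {f} refl′ trans′ a≤b = go (≤⇒≤′ a≤b)
  where
  go : ∀ {a b} → a ≤′ b → (∀ i → a ≤ i → i < b → R (f i) (f (suc i))) → R (f a) (f b)
  go (≤′-reflexive refl) _    = refl′
  go (≤′-step a≤′b)      step =
    trans′ (go a≤′b λ i a≤i i<b → step i a≤i (m<n⇒m<1+n i<b)) (step _ (≤′⇒≤ a≤′b) ≤-refl)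

map-upTo-suc : ∀ i k → map (i +_) (upTo (suc k)) ≡ i ∷ map (suc i +_) (upTo k)
map-upTo-suc i k = cong₂ _∷_ (+-identityʳ i) (begin
  map (i +_) (applyUpTo suc k)   ≡⟨ cong (map (i +_)) (map-upTo suc k) ⟨
  map (i +_) (map suc (upTo k))  ≡⟨ map-∘ (upTo k) ⟨
  map ((i +_) ∘ suc) (upTo k)    ≡⟨ map-cong (+-suc i) (upTo k) ⟩
  map (suc i +_) (upTo k)        ∎)
  where open ≡-Reasoning

rangeIJ-step : ∀ {i j} → i ≤ j → rangeIJ i j ≡ i ∷ rangeIJ (suc i) j
rangeIJ-step {i} {j} i≤j = trans (cong (map (i +_) ∘ upTo) (+-∸-assoc 1 i≤j)) (map-upTo-suc i (j ∸ i))

wAt-beyond : ∀ ω {i} → length ω < i → wAt ω i ≡ 0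
wAt-beyond []       _                       = refl
wAt-beyond (_ ∷ ws) {suc zero}    (s≤s ())
wAt-beyond (_ ∷ ws) {suc (suc i)} (s≤s m<i) = wAt-beyond ws m<i

tailSum : List ℕ → ℕ → ℕ
tailSum ω i = ωsum ω i (length ω)

tailSum-beyond : ∀ ω {i} → length ω < i → tailSum ω i ≡ 0
tailSum-beyond ω m<i rewrite m≤n⇒m∸n≡0 m<i = refl

tailSum-step : ∀ ω i → tailSum ω i ≡ wAt ω i + tailSum ω (suc i)
tailSum-step ω i with i ≤? length ω
... | yes i≤m = cong (sum ∘ map (wAt ω)) (rangeIJ-step i≤m)
... | no  i≰m = begin
  tailSum ω i                       ≡⟨ tailSum-beyond ω m<i ⟩
  0                                 ≡⟨ cong₂ _+_ (wAt-beyond ω m<i) (tailSum-beyond ω (m<n⇒m<1+n m<i)) ⟨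
  wAt ω i + tailSum ω (suc i)       ∎
  where
  open ≡-Reasoning
  m<i : length ω < i
  m<i = ≰⇒> i≰m

tailSum-positive⇒≤length : ∀ ω {i} → 1 ≤ tailSum ω i → i ≤ length ω
tailSum-positive⇒≤length ω {i} 1≤T with i ≤? length ω
... | yes i≤m = i≤m
... | no  i≰m = contradiction (subst (1 ≤_) (tailSum-beyond ω (≰⇒> i≰m)) 1≤T) λ ()

level : List ℕ → ℕ → ℕ → ℕ
level ω q y = q * y + tailSum ω y

level-step : ∀ ω q i → level ω q i + q ≡ level ω q (suc i) + wAt ω i
level-step ω q i = begin
  q * i + tailSum ω i + q                      ≡⟨ cong (λ t → q * i + t + q) (tailSum-step ω i) ⟩
  q * i + (wAt ω i + tailSum ω (suc i)) + q    ≡⟨ rearrange q i (wAt ω i) (tailSum ω (suc i)) ⟩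
  q * suc i + tailSum ω (suc i) + wAt ω i      ∎
  where
  open ≡-Reasoning
  rearrange : ∀ q i w t → q * i + (w + t) + q ≡ q * (1 + i) + t + w
  rearrange = solve 4 (λ q i w t → q :* i :+ (w :+ t) :+ q := q :* (con 1 :+ i) :+ t :+ w) refl
    where open ℕ.+-*-Solver

level-increasing : ∀ ω q {i} → wAt ω i < q → level ω q i < level ω q (suc i)
level-increasing ω q {i} w<q = +-cancelʳ-< q _ _ (begin-strict
  level ω q i + q              ≡⟨ level-step ω q i ⟩
  level ω q (suc i) + wAt ω i  <⟨ +-monoʳ-< (level ω q (suc i)) w<q ⟩
  level ω q (suc i) + q        ∎)
  where open ≤-Reasoning

level-nondecreasing : ∀ ω q {i} → wAt ω i ≤ q → level ω q i ≤ level ω q (suc i)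
level-nondecreasing ω q {i} w≤q = +-cancelʳ-≤ q _ _ (begin
  level ω q i + q              ≡⟨ level-step ω q i ⟩
  level ω q (suc i) + wAt ω i  ≤⟨ +-monoʳ-≤ (level ω q (suc i)) w≤q ⟩
  level ω q (suc i) + q        ∎)
  where open ≤-Reasoning

level-decreasing : ∀ ω q {i} → q < wAt ω i → level ω q (suc i) < level ω q i
level-decreasing ω q {i} q<w = +-cancelʳ-< (wAt ω i) _ _ (begin-strict
  level ω q (suc i) + wAt ω i  ≡⟨ level-step ω q i ⟨
  level ω q i + q              <⟨ +-monoʳ-< (level ω q i) q<w ⟩
  level ω q i + wAt ω i        ∎)
  where open ≤-Reasoning

level-strict-minimum : ∀ ω {q j y} →
  (∀ i → 1 ≤ i → i < j → q < wAt ω i) → wAt ω j < q → (∀ i → j < i → wAt ω i ≤ q) →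
  1 ≤ y → y ≢ j → level ω q j < level ω q y
level-strict-minimum ω {q} {j} {y} large small-j small 1≤y y≢j with <-cmp y j
... | tri< y<j _ _ = ≤-<-trans
  (adjacent⇒endpoints {R = _≥_} {level ω q} ≤-refl (flip ≤-trans) y<j
    λ i y<i i<j → <⇒≤ (level-decreasing ω q (large i (≤-trans 1≤y (<⇒≤ y<i)) i<j)))
  (level-decreasing ω q (large y 1≤y y<j))
... | tri≈ _ y≡j _ = contradiction y≡j y≢j
... | tri> _ _ j<y = <-≤-trans (level-increasing ω q small-j)
  (adjacent⇒endpoints {R = _≤_} {level ω q} ≤-refl ≤-trans j<y
    λ i j<i _ → level-nondecreasing ω q (small i j<i))

AntitoneUpTo : List ℕ → ℕ → Set
AntitoneUpTo ω m₀ = ∀ i → 1 ≤ i → i < m₀ → wAt ω (suc i) ≤ wAt ω i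

BinaryAfter : List ℕ → ℕ → Set
BinaryAfter ω m₀ = ∀ i → m₀ < i → i ≤ length ω → wAt ω i ≤ 1

m+1≤n⇒m<n : ∀ {m n} → m + 1 ≤ n → m < n
m+1≤n⇒m<n {m} {n} = subst (_≤ n) (+-comm m 1)

wAt-antitone : ∀ ω {m₀} → AntitoneUpTo ω m₀ →
  ∀ {a b} → 1 ≤ a → a ≤ b → b ≤ m₀ → wAt ω b ≤ wAt ω a
wAt-antitone ω step 1≤a a≤b b≤m₀ = adjacent⇒endpoints {R = _≥_} {wAt ω} ≤-refl (flip ≤-trans) a≤b
  λ i a≤i i<b → step i (≤-trans 1≤a a≤i) (<-≤-trans i<b b≤m₀)

wAt-large-before : ∀ ω {m₀ q j} → AntitoneUpTo ω m₀ →
  j ≤ m₀ + 1 → (j ≡ 1 ⊎ q + 1 ≤ wAt ω (j ∸ 1)) → ∀ i → 1 ≤ i → i < j → q < wAt ω i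
wAt-large-before _ _ _ (inj₁ refl) _ (s≤s z≤n) (s≤s ())
wAt-large-before ω {m₀} {j = suc j′} step j≤m₀+1 (inj₂ q+1≤w) i 1≤i (s≤s i≤j′) =
  <-≤-trans (m+1≤n⇒m<n q+1≤w) (wAt-antitone ω step 1≤i i≤j′ j′≤m₀)
  where
  j′≤m₀ : j′ ≤ m₀
  j′≤m₀ = ≤-pred (subst (suc j′ ≤_) (+-comm m₀ 1) j≤m₀+1)

wAt-small-after : ∀ ω {m₀ q j} → AntitoneUpTo ω m₀ → BinaryAfter ω m₀ →
  1 ≤ j → wAt ω j < q → ∀ i → j < i → wAt ω i ≤ q
wAt-small-after ω {m₀} {q} step binary 1≤j w<q i j<i with i ≤? m₀ | i ≤? length ω
... | yes i≤m₀ | _       = ≤-trans (wAt-antitone ω step 1≤j (<⇒≤ j<i) i≤m₀) (<⇒≤ w<q)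
... | no  i≰m₀ | yes i≤m = ≤-trans (binary i (≰⇒> i≰m₀) i≤m) (≤-trans (s≤s z≤n) w<q)
... | no  _    | no  i≰m = subst (_≤ q) (sym (wAt-beyond ω (≰⇒> i≰m))) z≤n

line-points⊆staircase : ∀ ω {q j x y} →
  (∀ i → 1 ≤ i → i < j → q < wAt ω i) → wAt ω j < q → (∀ i → j < i → wAt ω i ≤ q) →
  1 ≤ x → 1 ≤ y → q * y + x ≡ q * j + (tailSum ω j + 1) → (x , y) ≢ (tailSum ω j + 1 , j) →
  y ≤ length ω × x ≤ tailSum ω y
line-points⊆staircase ω {q} {j} {x} {y} large small-j small 1≤x 1≤y on-line xy≢p =
  tailSum-positive⇒≤length ω (≤-trans 1≤x x≤tailSum) , x≤tailSum
  where
  y≢j : y ≢ j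
  y≢j refl = xy≢p (cong (_, y) (+-cancelˡ-≡ (q * y) x _ on-line))
  x≤tailSum : x ≤ tailSum ω y
  x≤tailSum = +-cancelˡ-≤ (q * y) x _ (begin
    q * y + x                  ≡⟨ on-line ⟩
    q * j + (tailSum ω j + 1)  ≡⟨ +-assoc (q * j) _ 1 ⟨
    level ω q j + 1            ≡⟨ +-comm _ 1 ⟩
    suc (level ω q j)          ≤⟨ level-strict-minimum ω large small-j small 1≤y y≢j ⟩
    level ω q y                ∎)
    where open ≤-Reasoning

corollary2 : (n : ℕ) → 1 ≤ n → (T : List Slope) → (c : Constants) →
    (ω : List ℕ) → ωsum ω 1 (length ω) ≤ n →
    (m₀ : ℕ) → 1 ≤ m₀ → m₀ ≤ length ω →
    (∀ i → 1 ≤ i → i < m₀ → wAt ω (suc i) ≤ wAt ω i) →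
    (∀ i → m₀ < i → i ≤ length ω → wAt ω i ≤ 1) →
    (∀ i x y → 1 ≤ i → i ≤ length ω → 1 ≤ x → x ≤ ωsum ω i (length ω) → 1 ≤ y → y ≤ i →
      InGrid n x y → UniquelySolvable n T c x y) →
    (j : ℕ) → 1 ≤ j → j ≤ m₀ + 1 →
    (q : ℕ) → fin (negRecip q) ∈ T → wAt ω j + 1 ≤ q → (j ≡ 1 ⊎ q + 1 ≤ wAt ω (j ∸ 1)) →
    InGrid n (ωsum ω j (length ω) + 1) j →
    UniquelySolvable n T c (ωsum ω j (length ω) + 1) j
corollary2 _ _ _ _ ω _ _ _ _ _ _ _ j _ _ zero _ w+1≤0 _ _ =
  contradiction (m+n≤o⇒n≤o (wAt ω j) w+1≤0) λ ()
corollary2 n _ T c ω _ m₀ _ _ antitone binary J-solvable j 1≤j j≤m₀+1 q@(suc r) slope∈T w+1≤q before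
           p∈grid X Y X-solves Y-solves =
  lineSum-cancel {n} {t} {X} {Y} {px} {j} p∈grid agree lineSums-agree
  where
  t : Slope
  t = fin (negRecip q)
  px : ℕ
  px = tailSum ω j + 1
  w<q : wAt ω j < q
  w<q = m+1≤n⇒m<n w+1≤q
  lineSums-agree : lineSum n t (key t px j) X ≡ lineSum n t (key t px j) Y
  lineSums-agree = trans (X-solves t slope∈T px j p∈grid) (sym (Y-solves t slope∈T px j p∈grid))
  agree : ∀ x y → InGrid n x y → key t x y ≡ key t px j → (x , y) ≢ (px , j) → X x y ≡ Y x y
  agree x y xy∈grid@((1≤x , _) , (1≤y , _)) same-key xy≢p =
    J-solvable y x y 1≤y (proj₁ in-J) 1≤x (proj₂ in-J) 1≤y ≤-refl xy∈grid X Y X-solves Y-solves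
    where
    in-J : y ≤ length ω × x ≤ tailSum ω y
    in-J = line-points⊆staircase ω (wAt-large-before ω antitone j≤m₀+1 before) w<q
      (wAt-small-after ω antitone binary 1≤j w<q) 1≤x 1≤y
      (key-negRecip-injective r {x} {y} {px} {j} same-key) xy≢p
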